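{- Given a concrete string graph $H$, there exists a LIN-edNCE grammar $\mathcal{G}$ which generates the language $\{H\}$. Moreover, this grammar can be effectively constructed and is in !-linear form.
   Context: A string graph is a directed graph (no self-loops) whose vertices are labelled node-vertex ($N$) or wire-vertex ($W$), with no edge between two node-vertices and every wire-vertex of in-degree and out-degree at most 1; a concrete string graph is one carrying no !-boxes. edNCE grammars (Handbook of Graph Grammars): a graph with embedding is $(H,C)$ with $C\subseteq\Sigma\times\Gamma\times\Gamma\times V_H\times\{in,out\}$ a set of connection instructions $(\sigma,\beta/\gamma,x,d)$; substituting $(D,C_D)$ for a node $v$ of $H$ removes $v$, adds $D$, and for each $\beta$-edge between a $\sigma$-labelled node $w$ and $v$ in direction $d$ and each instruction $(\sigma,\beta/\gamma,x,d)\in C_D$ adds a $\gamma$-edge between $w$ and $x$ in the same direction (and composes connection instructions accordingly). An edNCE grammar $(\Sigma,\Delta,\Gamma,\Omega,P,S)$ has terminal node labels $\Delta$, final edge labels $\Omega$, productions $X\to(D,C)$ for nonterminals $X$, and initial nonterminal $S$; its language is the set of isomorphism classes of graphs with only terminal node labels and final edge labels derivable from the single node labelled $S$. It is LIN-edNCE if every right-hand side has at most one nonterminal node. !-linear form: write the vertices of $H$ as $v_1,\dots,v_n$ and associate non-final edge labels $\alpha_1,\dots,\alpha_n$. A grammar is in !-linear form if: (1) it is LIN-edNCE; (2) there is a single final production, whose right-hand side is the empty graph; (3) in every sentential form containing a nonterminal node, every terminal vertex is joined to the nonterminal node by an edge in each direction, each such edge having some label $\alpha_i$; (4) every production except the final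 one has connection instructions specifying that both incoming and outgoing edges of type $\alpha_i$ are connected to the nonterminal; (5) for every $i$, at most one terminal vertex in the productions is incident to an edge with label $\alpha_i$. -}

module Defs where

open import Data.Nat using (ℕ; zero; suc; _+_)
open import Data.Fin using (Fin; zero; suc; splitAt; punchIn; _≟_)
open import Data.Bool using (Bool; true; false; _∧_; _∨_)
open import Data.Sum using (_⊎_; inj₁; inj₂)
open import Data.Product using (Σ; ∃; _×_; _,_)
open import Function using (_∘_; _↔_; Inverse)
open import Relation.Nullary using (¬_; does)
open import Relation.Binary.PropositionalEquality using (_≡_; _≢_)

-- vertex kinds: node-vertex (N) and wire-vertex (W)
data VKind : Set where
  N W : VKind

record StringGraph (n : ℕ) : Set where
  field
    kind   : Fin n → VKind
    edge   : Fin n → Fin n → Bool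
    noLoop : ∀ a → edge a a ≡ false
    noNN   : ∀ a b → kind a ≡ N → kind b ≡ N → edge a b ≡ false
    wireIn  : ∀ w → kind w ≡ W → ∀ a b → edge a w ≡ true → edge b w ≡ true → a ≡ b
    wireOut : ∀ w → kind w ≡ W → ∀ a b → edge w a ≡ true → edge w b ≡ true → a ≡ b

-- Graphs for edNCE grammars: node labels in Σ = Fin ns,
-- edge labels in Γ = Fin ng, node set Fin n.
-- edge u v γ = true  means a γ-labelled edge from u to v.

record Graph (ns ng n : ℕ) : Set where
  field
    lab  : Fin n → Fin ns
    edge : Fin n → Fin n → Fin ng → Bool

open Graph

record _≅_ {ns ng n n'} (A : Graph ns ng n) (B : Graph ns ng n') : Set where
  field
    bij      : Fin n ↔ Fin n'
    labPres  : ∀ u → lab B (Inverse.to bij u) ≡ lab A u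
    edgePres : ∀ u v γ → edge B (Inverse.to bij u) (Inverse.to bij v) γ ≡ edge A u v γ

data Dir : Set where
  inD outD : Dir

-- a production X → (D , C); the connection relation C is a finite set
-- C ⊆ Σ × Γ × Γ × V_D × {in,out}, given by its characteristic function:
-- conn σ β γ x d = true  iff  (σ, β/γ, x, d) ∈ C
record Production (ns ng : ℕ) : Set where
  field
    lhs  : Fin ns
    size : ℕ
    rhs  : Graph ns ng size
    conn : Fin ns → Fin ng → Fin ng → Fin size → Dir → Bool

open Production

anyFin : ∀ {n} → (Fin n → Bool) → Bool
anyFin {zero}  f = false
anyFin {suc n} f = f zero ∨ anyFin (f ∘ suc)

-- The nodes of the result are Fin (m + size p): the first m are the nodes
-- of H other than v (via punchIn v), the remaining ones are those of D.
substitute : ∀ {ns ng m} → Graph ns ng (suc m) → Fin (suc m) →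
             (p : Production ns ng) → Graph ns ng (m + size p)
lab (substitute {m = m} H v p) u with splitAt m u
... | inj₁ a = lab H (punchIn v a)
... | inj₂ x = lab (rhs p) x
edge (substitute {m = m} H v p) u u' γ with splitAt m u | splitAt m u'
... | inj₁ a | inj₁ b = edge H (punchIn v a) (punchIn v b) γ
... | inj₂ x | inj₂ y = edge (rhs p) x y γ
... | inj₁ a | inj₂ x =
  anyFin (λ β → edge H (punchIn v a) v β ∧ conn p (lab H (punchIn v a)) β γ x inD)
... | inj₂ x | inj₁ a =
  anyFin (λ β → edge H v (punchIn v a) β ∧ conn p (lab H (punchIn v a)) β γ x outD)

-- edNCE grammars (Σ = Fin ns, Γ = Fin ng finite alphabets,
-- Δ ⊆ Σ and Ω ⊆ Γ given by characteristic functions,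
-- finitely many productions prod : Fin np → Production)

record Grammar : Set where
  field
    ns ng np : ℕ
    terminal : Fin ns → Bool
    final    : Fin ng → Bool
    prod     : Fin np → Production ns ng
    start    : Fin ns
    startNT  : terminal start ≡ false
    prodNT   : ∀ i → terminal (lhs (prod i)) ≡ false

module _ (G : Grammar) where
  open Grammar G

  startGraph : Graph ns ng 1
  lab  startGraph _ = start
  edge startGraph _ _ _ = false

  data Derives : (n : ℕ) → Graph ns ng n → Set where
    init : Derives 1 startGraph
    step : ∀ {m} {K : Graph ns ng (suc m)} → Derives (suc m) K →
           (v : Fin (suc m)) (i : Fin np) → lab K v ≡ lhs (prod i) →
           Derives (m + size (prod i)) (substitute K v (prod i))

  IsTerminalGraph : ∀ {n} → Graph ns ng n → Set
  IsTerminalGraph K = (∀ u → terminal (lab K u) ≡ true) ×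
                      (∀ u v γ → edge K u v γ ≡ true → final γ ≡ true)

  InLanguage : ∀ {n} → Graph ns ng n → Set
  InLanguage {n} K = IsTerminalGraph K ×
                     Σ ℕ (λ m → Σ (Graph ns ng m) (λ K' → Derives m K' × (K' ≅ K)))

  embed : ∀ {n} → (VKind → Fin ns) → Fin ng → StringGraph n → Graph ns ng n
  lab  (embed nl el H) u = nl (StringGraph.kind H u)
  edge (embed nl el H) u v γ = StringGraph.edge H u v ∧ does (γ ≟ el)

  record GeneratesExactly {n} (H : StringGraph n) : Set where
    field
      nodeLabel  : VKind → Fin ns
      edgeLabel  : Fin ng
      nodeLabelDistinct : nodeLabel N ≢ nodeLabel W
      nodeLabelTerminal : ∀ k → terminal (nodeLabel k) ≡ true
      edgeLabelFinal    : final edgeLabel ≡ true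
      containsH : InLanguage (embed nodeLabel edgeLabel H)
      onlyH     : ∀ m (K : Graph ns ng m) → InLanguage K →
                  K ≅ embed nodeLabel edgeLabel H

  IsLIN : Set
  IsLIN = ∀ i (x y : Fin (size (prod i))) →
          terminal (lab (rhs (prod i)) x) ≡ false →
          terminal (lab (rhs (prod i)) y) ≡ false → x ≡ y

  NoNonterminal : Production ns ng → Set
  NoNonterminal p = ∀ x → terminal (lab (rhs p) x) ≡ true

  IncidentTo : ∀ {k} → Graph ns ng k → Fin ng → Fin k → Set
  IncidentTo D γ x = ∃ (λ z → (edge D x z γ ≡ true) ⊎ (edge D z x γ ≡ true))

  -- !-linear form, relative to the vertices v₁ … vₙ (= Fin n) of H
  record BangLinearForm (n : ℕ) : Set where
    field
      α          : Fin n → Fin ng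
      αNonFinal  : ∀ i → final (α i) ≡ false
      αInjective : ∀ i j → α i ≡ α j → i ≡ j
      lin        : IsLIN
      finalProd      : Fin np
      finalProdFinal : NoNonterminal (prod finalProd)
      finalProdEmpty : size (prod finalProd) ≡ 0
      finalProdUnique : ∀ i → NoNonterminal (prod i) → i ≡ finalProd
      joined : ∀ m (K : Graph ns ng m) → Derives m K →
               ∀ z → terminal (lab K z) ≡ false →
               ∀ u → terminal (lab K u) ≡ true →
               (∃ λ i → edge K u z (α i) ≡ true) ×
               (∃ λ i → edge K z u (α i) ≡ true) ×
               (∀ γ → edge K u z γ ≡ true → ∃ λ i → γ ≡ α i) ×
               (∀ γ → edge K z u γ ≡ true → ∃ λ i → γ ≡ α i)
      connects : ∀ i → i ≢ finalProd →
                 ∀ x → terminal (lab (rhs (prod i)) x) ≡ false →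
                 ∀ j σ → terminal σ ≡ true → ∀ d →
                 conn (prod i) σ (α j) (α j) x d ≡ true
      uniqueα : ∀ j p q (x : Fin (size (prod p))) (y : Fin (size (prod q))) →
                terminal (lab (rhs (prod p)) x) ≡ true →
                terminal (lab (rhs (prod q)) y) ≡ true →
                IncidentTo (rhs (prod p)) (α j) x →
                IncidentTo (rhs (prod q)) (α j) y →
                _≡_ {A = Σ (Fin np) (λ r → Fin (size (prod r)))} (p , x) (q , y)

-- The grammar has two productions.  The first rewrites S into H itself
-- (node labels N and W, every edge carrying the final label) together with a
-- nonterminal X, where X is joined to the i-th vertex in both directions by
-- an edge labelled αᵢ; the second erases X.  Every derivation is S ⇒ D ⇒ H,
-- so the language is {H}, and the αᵢ-edges to X, each touching only vertex i,
-- exhibit the !-linear form.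
module Submission where

open import Defs
open import Data.Nat using (ℕ; zero; suc; _+_)
open import Data.Fin using (Fin; zero; suc; splitAt; _↑ˡ_; _≟_)
open import Data.Fin.Properties using (splitAt-↑ˡ; splitAt⁻¹-↑ˡ; suc-injective)
open import Data.Bool using (Bool; true; false; _∧_)
open import Data.Sum using (inj₁; inj₂)
open import Data.Product using (Σ; ∃; _×_; _,_)
open import Data.Empty using (⊥; ⊥-elim)
open import Function using (Inverse; _↔_; mk↔ₛ′)
open import Function.Construct.Symmetry using (↔-sym)
open import Function.Construct.Composition using (_↔-∘_)
open import Relation.Nullary using (does; yes)
open import Relation.Nullary.Decidable using (dec-true)
open import Relation.Binary.PropositionalEquality

open Graph
open Production

module _ {ns ng : ℕ} where

  ≅-sym : ∀ {n n'} {A : Graph ns ng n} {B : Graph ns ng n'} → A ≅ B → B ≅ A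
  ≅-sym {A = A} {B} i = record
    { bij      = ↔-sym bij
    ; labPres  = λ u → trans (sym (labPres (from u))) (cong (lab B) (strictlyInverseˡ u))
    ; edgePres = λ u v γ → trans (sym (edgePres (from u) (from v) γ))
        (cong₂ (λ x y → edge B x y γ) (strictlyInverseˡ u) (strictlyInverseˡ v))
    }
    where
      open _≅_ i
      open Inverse bij

  ≅-trans : ∀ {n n' n''} {A : Graph ns ng n} {B : Graph ns ng n'} {C : Graph ns ng n''} →
            A ≅ B → B ≅ C → A ≅ C
  ≅-trans i j = record
    { bij      = bij j ↔-∘ bij i
    ; labPres  = λ u → trans (labPres j (to (bij i) u)) (labPres i u)
    ; edgePres = λ u v γ →
        trans (edgePres j (to (bij i) u) (to (bij i) v) γ) (edgePres i u v γ)
    }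
    where
      open _≅_
      open Inverse

does-≟-refl : ∀ {k} (x : Fin k) → does (x ≟ x) ≡ true
does-≟-refl x = dec-true (x ≟ x) refl

does-≟⇒≡ : ∀ {k} {x y : Fin k} → does (x ≟ y) ≡ true → x ≡ y
does-≟⇒≡ {x = x} {y} e with x ≟ y
... | yes x≡y = x≡y

true≢false : ∀ {b : Bool} → b ≡ true → b ≡ false → ⊥
true≢false refl ()

module _ {n : ℕ} where

  drop+0 : Fin (n + 0) → Fin n
  drop+0 u with splitAt n u
  ... | inj₁ a = a

  drop+0-↑ˡ : ∀ a → drop+0 (a ↑ˡ 0) ≡ a
  drop+0-↑ˡ a rewrite splitAt-↑ˡ n a 0 = refl

  splitAt-drop+0 : ∀ u → splitAt n u ≡ inj₁ (drop+0 u)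
  splitAt-drop+0 u with splitAt n u
  ... | inj₁ a = refl

  Fin-+0↔ : Fin (n + 0) ↔ Fin n
  Fin-+0↔ = mk↔ₛ′ drop+0 (_↑ˡ 0) drop+0-↑ˡ (λ u → splitAt⁻¹-↑ˡ (splitAt-drop+0 u))

module Construction {n : ℕ} (H : StringGraph n) where

  -- Node labels Fin 4 and edge labels Fin (suc n): label zero is the final
  -- edge label of H, and suc i plays the role of αᵢ.
  pattern S = zero
  pattern X = suc zero

  nodeLabel : VKind → Fin 4
  nodeLabel N = suc (suc zero)
  nodeLabel W = suc (suc (suc zero))

  terminal : Fin 4 → Bool
  terminal S             = false
  terminal X             = false
  terminal (suc (suc _)) = true

  final : Fin (suc n) → Bool
  final zero    = true
  final (suc _) = false

  nodeLabel-terminal : ∀ k → terminal (nodeLabel k) ≡ true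
  nodeLabel-terminal N = refl
  nodeLabel-terminal W = refl

  HwithX : Graph 4 (suc n) (suc n)
  lab  HwithX zero    = X
  lab  HwithX (suc a) = nodeLabel (StringGraph.kind H a)
  edge HwithX zero    zero    γ = false
  edge HwithX zero    (suc b) γ = does (γ ≟ suc b)
  edge HwithX (suc a) zero    γ = does (γ ≟ suc a)
  edge HwithX (suc a) (suc b) γ = StringGraph.edge H a b ∧ does (γ ≟ zero)

  S→HwithX : Production 4 (suc n)
  lhs  S→HwithX = S
  size S→HwithX = suc n
  rhs  S→HwithX = HwithX
  conn S→HwithX _ _ _ _ _ = true

  empty : Graph 4 (suc n) 0
  lab  empty ()
  edge empty ()

  X→∅ : Production 4 (suc n)
  lhs  X→∅ = X
  size X→∅ = 0
  rhs  X→∅ = empty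
  conn X→∅ _ _ _ () _

  productions : Fin 2 → Production 4 (suc n)
  productions zero       = S→HwithX
  productions (suc zero) = X→∅

  productions-lhs-nonterminal : ∀ i → terminal (lhs (productions i)) ≡ false
  productions-lhs-nonterminal zero       = refl
  productions-lhs-nonterminal (suc zero) = refl

  G : Grammar
  G = record
    { ns = 4 ; ng = suc n ; np = 2 ; terminal = terminal ; final = final
    ; prod = productions ; start = S ; startNT = refl
    ; prodNT = productions-lhs-nonterminal }

  HasTerminalLabel : ∀ {m} → Graph 4 (suc n) m → Set
  HasTerminalLabel K = ∀ u → terminal (lab K u) ≡ true

  terminal-not-rewritten : ∀ i {σ} → terminal σ ≡ true → σ ≢ lhs (productions i)
  terminal-not-rewritten i t e =
    true≢false t (trans (cong terminal e) (productions-lhs-nonterminal i))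

  H′ : Graph 4 (suc n) n
  H′ = embed G nodeLabel zero H

  H′-terminal : IsTerminalGraph G H′
  H′-terminal = (λ u → nodeLabel-terminal _) , edge-final
    where
      edge-final : ∀ u v γ → edge H′ u v γ ≡ true → final γ ≡ true
      edge-final u v zero    e = refl
      edge-final u v (suc g) e with StringGraph.edge H u v
      edge-final u v (suc g) () | true
      edge-final u v (suc g) () | false

  step₁ : Graph 4 (suc n) (suc n)
  step₁ = substitute (startGraph G) zero S→HwithX

  step₂ : Graph 4 (suc n) (n + 0)
  step₂ = substitute step₁ zero X→∅

  step₁-terminal : ∀ a → terminal (lab step₁ (suc a)) ≡ true
  step₁-terminal a = nodeLabel-terminal (StringGraph.kind H a)

  step₂-derivable : Derives G (n + 0) step₂
  step₂-derivable = step (step init zero zero refl) zero (suc zero) refl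

  step₂≅H′ : step₂ ≅ H′
  step₂≅H′ = record { bij = Fin-+0↔ ; labPres = labPres ; edgePres = edgePres }
    where
      labPres : ∀ u → lab H′ (drop+0 u) ≡ lab step₂ u
      labPres u with splitAt n u
      ... | inj₁ a = refl
      edgePres : ∀ u v γ → edge H′ (drop+0 u) (drop+0 v) γ ≡ edge step₂ u v γ
      edgePres u v γ with splitAt n u | splitAt n v
      ... | inj₁ a | inj₁ b = refl

  data SententialForm : (m : ℕ) → Graph 4 (suc n) m → Set where
    initial  : SententialForm 1 (startGraph G)
    expanded : SententialForm (suc n) step₁
    finished : ∀ {m} {K : Graph 4 (suc n) m} → K ≅ H′ → SententialForm m K

  ≅H′-terminal : ∀ {m} {K : Graph 4 (suc n) m} → K ≅ H′ → HasTerminalLabel K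
  ≅H′-terminal i u = trans (cong terminal (sym (_≅_.labPres i u))) (nodeLabel-terminal _)

  sententialForm : ∀ {m K} → Derives G m K → SententialForm m K
  sententialForm init = initial
  sententialForm (step d v i e) with sententialForm d
  sententialForm (step d zero zero       e)  | initial  = expanded
  sententialForm (step d zero (suc zero) ()) | initial
  sententialForm (step d zero zero       ()) | expanded
  sententialForm (step d zero (suc zero) e)  | expanded = finished step₂≅H′
  sententialForm (step d (suc a) i e) | expanded =
    ⊥-elim (terminal-not-rewritten i (step₁-terminal a) e)
  sententialForm (step d v i e) | finished iso =
    ⊥-elim (terminal-not-rewritten i (≅H′-terminal iso v) e)

  generates : GeneratesExactly G H
  generates = record
    { nodeLabel         = nodeLabel
    ; edgeLabel         = zero
    ; nodeLabelDistinct = λ ()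
    ; nodeLabelTerminal = nodeLabel-terminal
    ; edgeLabelFinal    = refl
    ; containsH         = H′-terminal , n + 0 , step₂ , step₂-derivable , step₂≅H′
    ; onlyH             = only
    }
    where
      only : ∀ m (K : Graph 4 (suc n) m) → InLanguage G K → K ≅ H′
      only m K ((t , _) , _ , K′ , d , i) with sententialForm d
      ... | initial    = ⊥-elim (true≢false (t _) (cong terminal (_≅_.labPres i zero)))
      ... | expanded   = ⊥-elim (true≢false (t _) (cong terminal (_≅_.labPres i zero)))
      ... | finished j = ≅-trans (≅-sym i) j

  joined : ∀ m (K : Graph 4 (suc n) m) → Derives G m K →
           ∀ z → terminal (lab K z) ≡ false →
           ∀ u → terminal (lab K u) ≡ true →
           (∃ λ i → edge K u z (suc i) ≡ true) ×
           (∃ λ i → edge K z u (suc i) ≡ true) ×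
           (∀ γ → edge K u z γ ≡ true → ∃ λ i → γ ≡ suc i) ×
           (∀ γ → edge K z u γ ≡ true → ∃ λ i → γ ≡ suc i)
  joined m K d z tz u tu with sententialForm d
  joined m K d z tz u () | initial
  joined m K d z tz u tu | finished iso = ⊥-elim (true≢false (≅H′-terminal iso z) tz)
  joined m K d (suc b) tz u tu | expanded = ⊥-elim (true≢false (step₁-terminal b) tz)
  joined m K d zero tz zero () | expanded
  joined m K d zero tz (suc a) tu | expanded =
    (a , does-≟-refl (suc a)) , (a , does-≟-refl (suc a)) ,
    (λ γ e → a , does-≟⇒≡ e) , (λ γ e → a , does-≟⇒≡ e)

  incident-α⇒same-vertex : ∀ j a → IncidentTo G HwithX (suc j) (suc a) → a ≡ j
  incident-α⇒same-vertex j a (zero , inj₁ e) = suc-injective (sym (does-≟⇒≡ e))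
  incident-α⇒same-vertex j a (zero , inj₂ e) = suc-injective (sym (does-≟⇒≡ e))
  incident-α⇒same-vertex j a (suc b , inj₁ e) with StringGraph.edge H a b
  incident-α⇒same-vertex j a (suc b , inj₁ ()) | true
  incident-α⇒same-vertex j a (suc b , inj₁ ()) | false
  incident-α⇒same-vertex j a (suc b , inj₂ e) with StringGraph.edge H b a
  incident-α⇒same-vertex j a (suc b , inj₂ ()) | true
  incident-α⇒same-vertex j a (suc b , inj₂ ()) | false

  bangLinear : BangLinearForm G n
  bangLinear = record
    { α               = suc
    ; αNonFinal       = λ i → refl
    ; αInjective      = λ i j → suc-injective
    ; lin             = lin
    ; finalProd       = suc zero
    ; finalProdFinal  = λ ()
    ; finalProdEmpty  = refl
    ; finalProdUnique = finalProdUnique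
    ; joined          = joined
    ; connects        = connects
    ; uniqueα         = uniqueα
    }
    where
      lin : IsLIN G
      lin zero zero    zero    _  _  = refl
      lin zero (suc a) y       tx ty = ⊥-elim (true≢false (step₁-terminal a) tx)
      lin zero zero    (suc b) tx ty = ⊥-elim (true≢false (step₁-terminal b) ty)
      lin (suc zero) ()

      finalProdUnique : ∀ i → NoNonterminal G (productions i) → i ≡ suc zero
      finalProdUnique zero       nn with () ← nn zero
      finalProdUnique (suc zero) nn = refl

      connects : ∀ i → i ≢ suc zero → ∀ x → terminal (lab (rhs (productions i)) x) ≡ false →
                 ∀ j σ → terminal σ ≡ true → ∀ d →
                 conn (productions i) σ (suc j) (suc j) x d ≡ true
      connects zero       _  _ _ _ _ _ _ = refl
      connects (suc zero) ne = ⊥-elim (ne refl)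

      uniqueα : ∀ j p q (x : Fin (size (productions p))) (y : Fin (size (productions q))) →
                terminal (lab (rhs (productions p)) x) ≡ true →
                terminal (lab (rhs (productions q)) y) ≡ true →
                IncidentTo G (rhs (productions p)) (suc j) x →
                IncidentTo G (rhs (productions q)) (suc j) y →
                _≡_ {A = Σ (Fin 2) (λ r → Fin (size (productions r)))} (p , x) (q , y)
      uniqueα j (suc zero) q          ()      y
      uniqueα j zero       (suc zero) x       ()
      uniqueα j zero       zero       zero    y       () _
      uniqueα j zero       zero       (suc a) zero    _  ()
      uniqueα j zero       zero       (suc a) (suc b) _  _ ia ib =
        cong (λ c → zero , suc c)
          (trans (incident-α⇒same-vertex j a ia) (sym (incident-α⇒same-vertex j b ib)))

mainTheorem6 : ∀ {n} (H : StringGraph n) →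
    Σ Grammar (λ G → GeneratesExactly G H × BangLinearForm G n)
mainTheorem6 H = G , generates , bangLinear
  where open Construction H
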